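{- Let $x:[t]\to\mathbb{Z}\setminus\{0\}$ be such that $(x(1),\ldots,x(t))$ is generalized Catalan. In the construction of $\pi$ associated to $x$ (described in the context), at every step $2\le q\le t$ the choice is well defined: whenever the first case does not apply, there exists an index $i\notin\{\pi(1),\ldots,\pi(q-1)\}$ with $x(i)>0$. Consequently the construction yields a well-defined permutation $\pi\in\mathfrak{S}_t$.
   Context: A list $(x_1,\ldots,x_t)$ of nonzero integers is generalized Catalan if $\sum_{i=1}^t x_i=0$ and $\sum_{i=1}^q x_i\ge0$ for all $1\le q\le t$. $[t]=\{1,\ldots,t\}$. Construction of $\pi$: set $\pi(1)=1$. For $2\le q\le t$, let $s=\min\{i\in[t]: i\notin\{\pi(1),\ldots,\pi(q-1)\},\ x(i)<0\}$ and $s'=\min\{i\in[t]: i\notin\{\pi(1),\ldots,\pi(q-1)\},\ x(i)>0\}$ (a minimum of the empty set is $\infty$). Then $\pi(q)=s$ if $s<\infty$ and $\sum_{i=1}^{q-1}x(\pi(i))+x(s)\ge0$; otherwise $\pi(q)=s'$. -}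

module Defs where

open import Data.Nat using (ℕ; zero; suc)
open import Data.Integer using (ℤ; _≤_; _<_; _<?_; _≤?_; _+_; 0ℤ)
open import Data.Fin using (Fin)
import Data.Fin.Properties as FinP
open import Data.List using (List; []; _∷_; _++_; [_]; map; take; length; allFin; foldr)
open import Data.List.Relation.Unary.All using (All)
open import Data.List.Membership.Propositional using (_∉_)
import Data.List.Membership.DecPropositional as DecMem
open import Data.Maybe using (Maybe; just; nothing; _>>=_)
open import Data.Product using (Σ; _×_)
open import Data.Bool using (Bool; true; false; _∧_; not)
open import Relation.Nullary using (¬_; does; yes; no)
open import Relation.Binary.PropositionalEquality using (_≡_; _≢_)
open import Data.Vec.Functional using (toList)

sumℤ : List ℤ → ℤ
sumℤ = foldr _+_ 0ℤ

IsGenCatalan : List ℤ → Set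
IsGenCatalan xs =
  All (λ a → a ≢ 0ℤ) xs
  × sumℤ xs ≡ 0ℤ
  × (∀ (q : ℕ) → 1 Data.Nat.≤ q → q Data.Nat.≤ length xs → 0ℤ ≤ sumℤ (take q xs))

-- x : [t] → ℤ, with [t] represented by Fin t (index i ↔ i+1)
listOf : ∀ {t} → (Fin t → ℤ) → List ℤ
listOf x = toList x

firstSat : ∀ {t} → (Fin t → Bool) → List (Fin t) → Maybe (Fin t)
firstSat p [] = nothing
firstSat p (i ∷ is) with p i
... | true  = just i
... | false = firstSat p is

-- s = min { i ∉ P : x(i) < 0 } (nothing = ∞)
minNegUnused : ∀ {t} → (Fin t → ℤ) → List (Fin t) → Maybe (Fin t)
minNegUnused {t} x P = firstSat (λ i → not (does (DecMem._∈?_ (FinP._≟_ {t}) i P)) ∧ does (x i <? 0ℤ)) (allFin _)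

-- s' = min { i ∉ P : x(i) > 0 } (nothing = ∞)
minPosUnused : ∀ {t} → (Fin t → ℤ) → List (Fin t) → Maybe (Fin t)
minPosUnused {t} x P = firstSat (λ i → not (does (DecMem._∈?_ (FinP._≟_ {t}) i P)) ∧ does (0ℤ <? x i)) (allFin _)

prefSum : ∀ {t} → (Fin t → ℤ) → List (Fin t) → ℤ
prefSum x P = sumℤ (map x P)

FirstCase : ∀ {t} → (Fin t → ℤ) → List (Fin t) → Set
FirstCase x P = Σ _ (λ s → minNegUnused x P ≡ just s × 0ℤ ≤ prefSum x P + x s)

-- one step of the construction, given P = [π(1),…,π(q-1)];
-- returns nothing exactly when the second case is needed and s' = ∞
step : ∀ {t} → (Fin t → ℤ) → List (Fin t) → Maybe (List (Fin t))
step x P with minNegUnused x P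
... | just s with 0ℤ ≤? prefSum x P + x s
...   | yes _ = just (P ++ [ s ])
...   | no  _ = second
  where
  second : Maybe (List (Fin _))
  second with minPosUnused x P
  ... | just s' = just (P ++ [ s' ])
  ... | nothing = nothing
step x P | nothing with minPosUnused x P
... | just s' = just (P ++ [ s' ])
... | nothing = nothing

-- build x q = just [π(1),…,π(q)] (nothing if the construction got stuck)
build : ∀ {t} → (Fin t → ℤ) → ℕ → Maybe (List (Fin t))
build x zero = just []
build {zero}  x (suc zero) = nothing
build {suc t} x (suc zero) = just [ Fin.zero ]
build x (suc (suc q)) = build x (suc q) >>= step x

{-# OPTIONS --safe #-}
-- If the second case is forced and no unused entry is positive, then every unused entry is
-- negative, and one exists since fewer than t indices are used; so s exists, and
-- 0 = x(1) + ⋯ + x(t) ≤ x(π(1)) + ⋯ + x(π(q-1)) + x(s), i.e. the first case applied after all.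
-- Hence every step appends a fresh index, and after t steps every index occurs exactly once.
-- Only the nonzero entries and the vanishing total sum are used, not the prefix sums.
module Submission where

open import Defs
import Data.Integer.Properties as ℤP
open import Algebra.Properties.CommutativeSemigroup ℤP.+-commutativeSemigroup using (interchange)
open import Data.Bool using (Bool; true; false; if_then_else_; not; _∧_)
open import Data.Fin using (Fin; zero; suc)
open import Data.Fin.Permutation using (Permutation; Permutation′; _⟨$⟩ʳ_; permutation)
import Data.Fin.Permutation as Perm
open import Data.Fin.Properties using (_≟_; ¬∀⟶∃¬; <⇒notInjective; any?)
open import Data.Integer using (ℤ; 0ℤ; _+_; _≤_; _<_; _<?_; _≤?_)
open import Data.List using (List; []; _∷_; _++_; [_]; map; tabulate; allFin; length; lookup)
open import Data.List.Membership.Propositional using (_∈_; _∉_)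
open import Data.List.Membership.Propositional.Properties using (∈-lookup; ∈-allFin)
import Data.List.Membership.DecPropositional as DecMembership
open import Data.List.Properties using (tabulate-lookup; map-tabulate; length-++)
import Data.List.Relation.Unary.All as All
open import Data.List.Relation.Unary.All.Properties using (tabulate⁻; ¬Any⇒All¬)
open import Data.List.Relation.Unary.AllPairs using ([]; _∷_)
open import Data.List.Relation.Unary.Any using (here; there; index)
open import Data.List.Relation.Unary.Any.Properties using (lookup-index)
open import Data.List.Relation.Unary.Unique.Propositional using (Unique)
open import Data.List.Relation.Unary.Unique.Propositional.Properties using (Unique[x∷xs]⇒x∉xs; ++⁺)
open import Data.Maybe using (Maybe; just; nothing; _>>=_)
open import Data.Maybe.Properties using (just-injective)
open import Data.Nat as ℕ using (ℕ; zero; suc; _∸_; s≤s; z≤n)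
import Data.Nat.Properties as ℕP
open import Data.Product using (Σ; ∃; _×_; _,_; proj₂)
open import Data.Empty using (⊥-elim)
open import Function using (id; _∘_)
open import Function.Definitions using (Injective)
open import Relation.Nullary using (¬_; Dec; yes; no; does; ¬?; _×-dec_; contradiction)
open import Relation.Nullary.Decidable using (dec-true; dec-false)
open import Relation.Unary using (Pred; Decidable)
open import Relation.Binary.PropositionalEquality hiding ([_])

∑ : ∀ {n} → (Fin n → ℤ) → ℤ
∑ f = sumℤ (tabulate f)

∑-zero : ∀ {n} → ∑ {n} (λ _ → 0ℤ) ≡ 0ℤ
∑-zero {zero}  = refl
∑-zero {suc n} = trans (ℤP.+-identityˡ _) (∑-zero {n})

∑-+ : ∀ {n} (f g : Fin n → ℤ) → ∑ (λ i → f i + g i) ≡ ∑ f + ∑ g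
∑-+ {zero}  f g = refl
∑-+ {suc n} f g =
  trans (cong (f zero + g zero +_) (∑-+ (f ∘ suc) (g ∘ suc)))
        (interchange (f zero) (g zero) (∑ (f ∘ suc)) (∑ (g ∘ suc)))

∑-mono-≤ : ∀ {n} {f g : Fin n → ℤ} → (∀ i → f i ≤ g i) → ∑ f ≤ ∑ g
∑-mono-≤ {zero}  f≤g = ℤP.≤-refl
∑-mono-≤ {suc n} f≤g = ℤP.+-mono-≤ (f≤g zero) (∑-mono-≤ (f≤g ∘ suc))

point : ∀ {n} → Fin n → ℤ → Fin n → ℤ
point p a i = if does (i ≟ p) then a else 0ℤ

point-≡ : ∀ {n} (p : Fin n) a → point p a p ≡ a
point-≡ p a = cong (if_then a else 0ℤ) (dec-true (p ≟ p) refl)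

point-≢ : ∀ {n} {i p : Fin n} a → i ≢ p → point p a i ≡ 0ℤ
point-≢ {i = i} {p} a i≢p = cong (if_then a else 0ℤ) (dec-false (i ≟ p) i≢p)

∑-point : ∀ {n} (p : Fin n) a → ∑ (point p a) ≡ a
∑-point {suc n} zero a = trans (cong (a +_) (∑-zero {n})) (ℤP.+-identityʳ a)
∑-point (suc p) a      = trans (ℤP.+-identityˡ _) (∑-point p a)

_∈?_ : ∀ {n} (i : Fin n) (P : List (Fin n)) → Dec (i ∈ P)
i ∈? P = DecMembership._∈?_ _≟_ i P

select : ∀ {n} → List (Fin n) → (Fin n → ℤ) → Fin n → ℤ
select []      w i = 0ℤ
select (p ∷ L) w i = point p (w p) i + select L w i

∑-select : ∀ {n} (L : List (Fin n)) w → ∑ (select L w) ≡ sumℤ (map w L)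
∑-select {n} []      w = ∑-zero {n}
∑-select (p ∷ L) w = begin
  ∑ (select (p ∷ L) w)               ≡⟨ ∑-+ (point p (w p)) (select L w) ⟩
  ∑ (point p (w p)) + ∑ (select L w) ≡⟨ cong₂ _+_ (∑-point p (w p)) (∑-select L w) ⟩
  w p + sumℤ (map w L)               ∎
  where open ≡-Reasoning

select-∉ : ∀ {n} {L : List (Fin n)} {i} w → i ∉ L → select L w i ≡ 0ℤ
select-∉ {L = []}    w i∉L = refl
select-∉ {L = p ∷ L} {i} w i∉L =
  trans (cong₂ _+_ (point-≢ {i = i} (w p) (i∉L ∘ here)) (select-∉ w (i∉L ∘ there))) (ℤP.+-identityˡ 0ℤ)

select-∈ : ∀ {n} {L : List (Fin n)} {i} w → Unique L → i ∈ L → select L w i ≡ w i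
select-∈ {L = p ∷ L} w uq (here refl) =
  trans (cong₂ _+_ (point-≡ p (w p)) (select-∉ w (Unique[x∷xs]⇒x∉xs uq))) (ℤP.+-identityʳ (w p))
select-∈ {L = p ∷ L} {i} w uq@(_ ∷ uqL) (there i∈L) =
  trans (cong₂ _+_ (point-≢ {i = i} (w p) λ { refl → Unique[x∷xs]⇒x∉xs uq i∈L }) (select-∈ w uqL i∈L))
        (ℤP.+-identityˡ _)

∑≤sum-map : ∀ {n} {L : List (Fin n)} {w} → Unique L → (∀ i → i ∉ L → w i ≤ 0ℤ) →
            ∑ w ≤ sumℤ (map w L)
∑≤sum-map {L = L} {w} uq nonpos = begin
  ∑ w            ≤⟨ ∑-mono-≤ w≤select ⟩
  ∑ (select L w) ≡⟨ ∑-select L w ⟩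
  sumℤ (map w L) ∎
  where
  open ℤP.≤-Reasoning
  w≤select : ∀ i → w i ≤ select L w i
  w≤select i with i ∈? L
  ... | yes i∈L = ℤP.≤-reflexive (sym (select-∈ w uq i∈L))
  ... | no  i∉L = ℤP.≤-trans (nonpos i i∉L) (ℤP.≤-reflexive (sym (select-∉ w i∉L)))

lookup-injective : ∀ {a} {A : Set a} {xs : List A} → Unique xs → Injective _≡_ _≡_ (lookup xs)
lookup-injective {xs = _ ∷ _} _          {zero}  {zero}  _ = refl
lookup-injective (x∉xs ∷ _)  {zero}  {suc j} x≡ = contradiction x≡ (All.lookup x∉xs (∈-lookup j))
lookup-injective (x∉xs ∷ _)  {suc i} {zero}  ≡x = contradiction (sym ≡x) (All.lookup x∉xs (∈-lookup i))
lookup-injective (_ ∷ uq)    {suc i} {suc j} eq = cong suc (lookup-injective uq eq)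

length<⇒∃∉ : ∀ {n} (P : List (Fin n)) → length P ℕ.< n → ∃ λ u → u ∉ P
length<⇒∃∉ {n} P short = ¬∀⟶∃¬ n (_∈ P) (_∈? P) λ cover →
  <⇒notInjective short λ {u} {v} eq →
    trans (lookup-index (cover u)) (trans (cong (lookup P) eq) (sym (lookup-index (cover v))))

length≡⇒covering : ∀ {n} {P : List (Fin n)} → Unique P → length P ≡ n → ∀ u → u ∈ P
length≡⇒covering {P = P} uq len≡ u with u ∈? P
... | yes u∈P = u∈P
... | no  u∉P = ⊥-elim (<⇒notInjective (ℕP.≤-reflexive (cong suc (sym len≡)))
                                       (lookup-injective (¬Any⇒All¬ P u∉P ∷ uq)))

covering⇒permutation : ∀ {n} {P : List (Fin n)} → Unique P → (∀ u → u ∈ P) →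
                       Σ (Permutation (length P) n) λ π → tabulate (π ⟨$⟩ʳ_) ≡ P
covering⇒permutation {P = P} uq cover =
  permutation (lookup P) (index ∘ cover)
    (λ u → sym (lookup-index (cover u)))
    (λ i → lookup-injective uq (sym (lookup-index (cover (lookup P i)))))
  , tabulate-lookup P

firstSat-true : ∀ {n} (p : Fin n → Bool) l {i} → firstSat p l ≡ just i → p i ≡ true
firstSat-true p (j ∷ l) e with p j in pj
firstSat-true p (j ∷ l) refl | true  = pj
...                          | false = firstSat-true p l e

firstSat-just : ∀ {n} (p : Fin n → Bool) {l i} → i ∈ l → p i ≡ true → ∃ λ j → firstSat p l ≡ just j
firstSat-just p {j ∷ l} i∈l pi with p j in pj
... | true = j , refl
firstSat-just p {j ∷ l} (here refl)  pi | false = contradiction (trans (sym pj) pi) λ ()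
firstSat-just p {j ∷ l} (there i∈l) pi | false = firstSat-just p i∈l pi

firstUnused : ∀ {n q} {Q : Pred (Fin n) q} → Decidable Q → List (Fin n) → Maybe (Fin n)
firstUnused Q? P = firstSat (λ i → not (does (i ∈? P)) ∧ does (Q? i)) (allFin _)

firstUnused-∉ : ∀ {n q} {Q : Pred (Fin n) q} (Q? : Decidable Q) {P s} →
                firstUnused Q? P ≡ just s → s ∉ P
firstUnused-∉ Q? {P} {s} e s∈P = contradiction (firstSat-true _ (allFin _) e)
  (subst (λ b → not b ∧ does (Q? s) ≢ true) (sym (dec-true (s ∈? P) s∈P)) λ ())

firstUnused-just : ∀ {n q} {Q : Pred (Fin n) q} (Q? : Decidable Q) {P u} →
                   u ∉ P → Q u → ∃ λ s → firstUnused Q? P ≡ just s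
firstUnused-just Q? {P} {u} u∉P Qu = firstSat-just _ (∈-allFin u)
  (cong₂ (λ a b → not a ∧ b) (dec-false (u ∈? P) u∉P) (dec-true (Q? u) Qu))

module _ {t : ℕ} {x : Fin t → ℤ} where

  negative? : Decidable (λ i → x i < 0ℤ)
  negative? i = x i <? 0ℤ

  positive? : Decidable (λ i → 0ℤ < x i)
  positive? i = 0ℤ <? x i

  unused≤0⇒firstCase : ∀ {P s} → ∑ x ≡ 0ℤ → Unique P →
    minNegUnused x P ≡ just s → (∀ i → i ∉ P → x i ≤ 0ℤ) → FirstCase x P
  unused≤0⇒firstCase {P} {s} ∑x≡0 uq minNeg≡s nonpos = s , minNeg≡s , (begin
    0ℤ                    ≡⟨ sym ∑x≡0 ⟩
    ∑ x                   ≤⟨ ∑≤sum-map (¬Any⇒All¬ P s∉P ∷ uq) (λ i i∉ → nonpos i (i∉ ∘ there)) ⟩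
    x s + prefSum x P     ≡⟨ ℤP.+-comm (x s) _ ⟩
    prefSum x P + x s     ∎)
    where
    open ℤP.≤-Reasoning
    s∉P : s ∉ P
    s∉P = firstUnused-∉ negative? minNeg≡s

  module _ (x≢0 : ∀ i → x i ≢ 0ℤ) (∑x≡0 : ∑ x ≡ 0ℤ) where

    unusedPositive : ∀ {P} → Unique P → length P ℕ.< t → ¬ FirstCase x P →
                     ∃ λ i → i ∉ P × 0ℤ < x i
    unusedPositive {P} uq short ¬first with any? (λ i → ¬? (i ∈? P) ×-dec positive? i)
    ... | yes found = found
    ... | no  none  = contradiction
      (unused≤0⇒firstCase ∑x≡0 uq (proj₂ minNegDefined) unused≤0) ¬first
      where
      unused≤0 : ∀ i → i ∉ P → x i ≤ 0ℤ
      unused≤0 i i∉P = ℤP.≮⇒≥ λ 0<xi → none (i , i∉P , 0<xi)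
      minNegDefined : ∃ λ s → minNegUnused x P ≡ just s
      minNegDefined = let u , u∉P = length<⇒∃∉ P short in
        firstUnused-just negative? u∉P (ℤP.≤∧≢⇒< (unused≤0 u u∉P) (x≢0 u))

    minPosUnused≢nothing : ∀ {P} → Unique P → length P ℕ.< t → ¬ FirstCase x P →
                           minPosUnused x P ≢ nothing
    minPosUnused≢nothing uq short ¬first minPos≡nothing =
      let i , i∉P , 0<xi = unusedPositive uq short ¬first
          s , minPos≡s   = firstUnused-just positive? i∉P 0<xi
      in contradiction (trans (sym minPos≡nothing) minPos≡s) λ ()

    step-appends-fresh : ∀ {P} → Unique P → length P ℕ.< t →
                         ∃ λ s → s ∉ P × step x P ≡ just (P ++ [ s ])
    step-appends-fresh {P} uq short with minNegUnused x P in minNeg≡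
    ... | just s with 0ℤ ≤? prefSum x P + x s
    ...   | yes _ = s , firstUnused-∉ negative? minNeg≡ , refl
    ...   | no ¬0≤ with minPosUnused x P in minPos≡
    ...     | just s′ = s′ , firstUnused-∉ positive? minPos≡ , refl
    ...     | nothing = contradiction minPos≡ (minPosUnused≢nothing uq short ¬first)
      where
      ¬first : ¬ FirstCase x P
      ¬first (s′ , minNeg≡s′ , 0≤) =
        ¬0≤ (subst (λ r → 0ℤ ≤ prefSum x P + x r) (just-injective (trans (sym minNeg≡s′) minNeg≡)) 0≤)
    step-appends-fresh {P} uq short | nothing with minPosUnused x P in minPos≡
    ... | just s′ = s′ , firstUnused-∉ positive? minPos≡ , refl
    ... | nothing = contradiction minPos≡ (minPosUnused≢nothing uq short
                      λ (_ , minNeg≡s , _) → contradiction (trans (sym minNeg≡) minNeg≡s) λ ())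

build-unique : ∀ {t} {x : Fin t → ℤ} → (∀ i → x i ≢ 0ℤ) → ∑ x ≡ 0ℤ → ∀ k → suc k ℕ.≤ t →
              ∃ λ P → build x (suc k) ≡ just P × Unique P × length P ≡ suc k
build-unique {suc t} _ _ zero _ = [ zero ] , refl , All.[] ∷ [] , refl
-- build splits on t in its earlier clauses, so build x (suc (suc k)) only unfolds once t is a suc.
build-unique {suc t} {x} x≢0 ∑x≡0 (suc k) k+2≤t
  with P , build≡P , uq , len≡ ← build-unique x≢0 ∑x≡0 k (ℕP.<⇒≤ k+2≤t)
  with s , s∉P , step≡ ← step-appends-fresh x≢0 ∑x≡0 uq (subst (ℕ._< _) (sym len≡) k+2≤t)
  = P ++ [ s ]
  , trans (cong (_>>= step x) build≡P) step≡
  , ++⁺ uq (All.[] ∷ []) (λ { (v∈P , here refl) → s∉P v∈P })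
  , trans (length-++ P) (trans (cong (ℕ._+ 1) len≡) (ℕP.+-comm (suc k) 1))

build-permutation : ∀ {t} {x : Fin t → ℤ} → (∀ i → x i ≢ 0ℤ) → ∑ x ≡ 0ℤ →
                    ∃ λ (π : Permutation′ t) → build x t ≡ just (map (π ⟨$⟩ʳ_) (allFin t))
build-permutation {zero} _ _ = Perm.id , refl
build-permutation {suc t} x≢0 ∑x≡0
  with P , build≡P , uq , len≡ ← build-unique x≢0 ∑x≡0 t ℕP.≤-refl
  with π , tabulate≡P ← subst (λ m → Σ (Permutation m (suc t)) λ π → tabulate (π ⟨$⟩ʳ_) ≡ P) len≡
                          (covering⇒permutation uq (length≡⇒covering uq len≡))
  = π , trans build≡P (cong just (trans (sym tabulate≡P) (sym (map-tabulate id (π ⟨$⟩ʳ_)))))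

lemma2p1 : (t : ℕ) (x : Fin t → ℤ) → IsGenCatalan (listOf x) →
    (∀ (q : ℕ) → 2 ℕ.≤ q → q ℕ.≤ t → (P : List (Fin t)) → build x (q ∸ 1) ≡ just P →
      ¬ FirstCase x P → ∃ (λ i → i ∉ P × 0ℤ < x i))
    × ∃ (λ (π : Permutation′ t) → build x t ≡ just (map (π ⟨$⟩ʳ_) (allFin t)))
lemma2p1 t x (nonzero , ∑x≡0 , _) = positiveUnusedWhenForced , build-permutation x≢0 ∑x≡0
  where
  x≢0 : ∀ i → x i ≢ 0ℤ
  x≢0 = tabulate⁻ nonzero
  positiveUnusedWhenForced : ∀ q → 2 ℕ.≤ q → q ℕ.≤ t → (P : List (Fin t)) → build x (q ∸ 1) ≡ just P →
                             ¬ FirstCase x P → ∃ λ i → i ∉ P × 0ℤ < x i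
  positiveUnusedWhenForced (suc (suc k)) (s≤s (s≤s z≤n)) q≤t P build≡P ¬first
    with P′ , build≡P′ , uq , len≡ ← build-unique x≢0 ∑x≡0 k (ℕP.<⇒≤ q≤t)
    with refl ← just-injective (trans (sym build≡P′) build≡P)
    = unusedPositive x≢0 ∑x≡0 uq (subst (ℕ._< t) (sym len≡) q≤t) ¬first
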